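{- Suppose $M(A)$ and $N(B)$ are matched. (1) If $M'(A)$ and $N'(B)$ are matched, with $M\leq M'$ and $N\leq N'$ in the weak order, then $M\mathbin{\Join} N\leq M'\mathbin{\Join} N'$. (2) If $N'(B)$ is such that $(M,N')$ is matched and $N\unlhd N'$, then $M\mathbin{\Join} N\unlhd M\mathbin{\Join} N'$. (3) If $M'(A)$ is such that $(M',N)$ is matched and $M\unlhd M'$, then $M\mathbin{\Join} N\unlhd M'\mathbin{\Join} N$.
   Context: $M.X$ is contraction of $M$ to $X$ (i.e. $M/(E-X)$), $M|X$ restriction. $M(A)$, $N(B)$ matched means $M.(A\cap B)=N|(A\cap B)$. Free splice $M\mathbin{\Join} N$: matroid on $A\cup B$ with rank $r(X)=\min\{r_M(X\cap A)+|X-A|,\ r_N(X\cap B)+r_M(A-B)\}$. Weak order: $L\le P$ iff every independent set of $L$ is independent in $P$. Strong order: $L\unlhd P$ iff every flat of $L$ is a flat of $P$ (same ground set). -}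

module Defs where

open import Data.Nat using (ℕ; _+_; _∸_; _≤_; _<_; _⊓_)
open import Data.Fin using (Fin)
open import Data.Fin.Subset using (Subset; _∪_; _∩_; _─_; _⊆_; _∈_; _∉_; ∣_∣; ⁅_⁆)
open import Data.Product using (_×_)
open import Relation.Binary.PropositionalEquality using (_≡_)

-- A "rank system": a ground set E ⊆ Fin n together with a function on subsets.
-- Only the values on subsets of the ground set are meaningful.
record RankSys (n : ℕ) : Set where
  field
    ground : Subset n
    rank   : Subset n → ℕ
open RankSys public

record Matroid {n : ℕ} (E : Subset n) : Set where
  field
    r      : Subset n → ℕ
    r-card : ∀ X → X ⊆ E → r X ≤ ∣ X ∣
    r-mono : ∀ X Y → X ⊆ Y → Y ⊆ E → r X ≤ r Y
    r-sub  : ∀ X Y → X ⊆ E → Y ⊆ E → r (X ∪ Y) + r (X ∩ Y) ≤ r X + r Y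
open Matroid public

sys : ∀ {n} {E : Subset n} → Matroid E → RankSys n
sys {E = E} M = record { ground = E ; rank = r M }

_≅_ : ∀ {n} → RankSys n → RankSys n → Set
S ≅ T = (ground S ≡ ground T) × (∀ X → X ⊆ ground S → rank S X ≡ rank T X)

-- Contraction S.X = S/(E − X): rank Y = r(Y ∪ (E−X)) − r(E−X).
_∙_ : ∀ {n} → RankSys n → Subset n → RankSys n
S ∙ X = record { ground = X
               ; rank = λ Y → rank S (Y ∪ (ground S ─ X)) ∸ rank S (ground S ─ X) }

_∣'_ : ∀ {n} → RankSys n → Subset n → RankSys n
S ∣' X = record { ground = X ; rank = rank S }

Matched : ∀ {n} {A B : Subset n} → Matroid A → Matroid B → Set
Matched {A = A} {B} M N = (sys M ∙ (A ∩ B)) ≅ (sys N ∣' (A ∩ B))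

_⋈_ : ∀ {n} {A B : Subset n} → Matroid A → Matroid B → RankSys n
_⋈_ {A = A} {B} M N = record
  { ground = A ∪ B
  ; rank = λ X → (r M (X ∩ A) + ∣ X ─ A ∣) ⊓ (r N (X ∩ B) + r M (A ─ B)) }

Indep : ∀ {n} → RankSys n → Subset n → Set
Indep S X = X ⊆ ground S × rank S X ≡ ∣ X ∣

Flat : ∀ {n} → RankSys n → Subset n → Set
Flat S X = X ⊆ ground S × (∀ e → e ∈ ground S → e ∉ X → rank S X < rank S (X ∪ ⁅ e ⁆))

_≤w_ : ∀ {n} → RankSys n → RankSys n → Set
L ≤w P = (ground L ≡ ground P) × (∀ X → Indep L X → Indep P X)

_⊴_ : ∀ {n} → RankSys n → RankSys n → Set
L ⊴ P = (ground L ≡ ground P) × (∀ X → Flat L X → Flat P X)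

-- The rank of M ⋈ N is the minimum of ρ₁ X = r_M(X ∩ A) + |X − A| and ρ₂ X = r_N(X ∩ B) + r_M(A − B).
-- (1) In the weak order ranks can only grow (compare on a basis), so both terms grow while ρ₁ ≤ |X|
-- keeps independent sets tight.
-- (2,3) In the strong order M ⊴ P the difference r_P − r_M is monotone and every strict increase
-- r_M Y < r_M (Y + e) persists in P, because cl_M Y is a flat of P. For a flat X of M ⋈ N and
-- e ∉ X, ρ₁ always increases: if it did not, X ⊇ A − B and matchedness turns e ∈ cl_M(X ∩ A) into
-- e ∈ cl_N(X ∩ B), contradicting flatness through ρ₂. It then suffices that whichever of the new
-- terms is the minimum at X strictly increases; for ρ₂ in (3) one uses ρ₁' − ρ₁ ≤ ρ₂' − ρ₂.
module Submission where

open import Defs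
open import Data.Empty using (⊥-elim)
open import Data.Fin using (Fin; zero; suc)
open import Data.Fin.Subset
open import Data.Fin.Subset.Properties
open import Data.Nat using (ℕ; zero; suc; _+_; _∸_; _≤_; _<_; _⊓_; _≤?_)
open import Data.Nat.Properties
open import Algebra.Properties.CommutativeSemigroup +-commutativeSemigroup using () renaming (interchange to +-interchange; x∙yz≈y∙xz to +-left-comm)
open import Data.Product using (_×_; _,_; proj₁; proj₂; Σ-syntax)
open import Data.Sum using (inj₁; inj₂)
open import Data.Vec using (_∷_; []; tabulate; here; there)
open import Data.Vec.Properties using ([]=⇒lookup; lookup⇒[]=; lookup∘tabulate)
open import Relation.Nullary using (¬_; yes; no)
open import Relation.Nullary.Decidable using (isYes; _×-dec_)
open import Relation.Unary using (Pred; Decidable)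
open import Relation.Binary.PropositionalEquality
open import Function using (_∘_)
open import Level using (0ℓ)

-- Subsets

private variable
  n : ℕ
  x : Fin n
  p q s : Subset n

∪-least : p ⊆ s → q ⊆ s → p ∪ q ⊆ s
∪-least {p = p} {q = q} p⊆s q⊆s x∈ with x∈p∪q⁻ p q x∈
... | inj₁ x∈p = p⊆s x∈p
... | inj₂ x∈q = q⊆s x∈q

x∈p⇒⁅x⁆⊆p : x ∈ p → ⁅ x ⁆ ⊆ p
x∈p⇒⁅x⁆⊆p {x = x} {p} x∈p y∈⁅x⁆ = subst (_∈ p) (sym (x∈⁅y⁆⇒x≡y x y∈⁅x⁆)) x∈p

p⊆q⇒p∪q≡q : p ⊆ q → p ∪ q ≡ q
p⊆q⇒p∪q≡q {p = p} {q} p⊆q = ⊆-antisym (∪-least p⊆q ⊆-refl) (q⊆p∪q p q)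

x∈p─q⇒x∉q : ∀ (p q : Subset n) → x ∈ p ─ q → x ∉ q
x∈p─q⇒x∉q (_ ∷ p) (outside ∷ q) here      ()
x∈p─q⇒x∉q (_ ∷ p) (_ ∷ q)       (there h) (there h') = x∈p─q⇒x∉q p q h h'

∪⁅⁆-∩-∉ : ∀ (p : Subset n) → x ∉ q → (p ∪ ⁅ x ⁆) ∩ q ≡ p ∩ q
∪⁅⁆-∩-∉ {x = x} {q} p x∉q = ⊆-antisym shrink grow
  where
  shrink : (p ∪ ⁅ x ⁆) ∩ q ⊆ p ∩ q
  shrink h with x∈p∩q⁻ _ q h
  ... | y∈ , y∈q with x∈p∪q⁻ p ⁅ x ⁆ y∈
  ... | inj₁ y∈p   = x∈p∩q⁺ (y∈p , y∈q)
  ... | inj₂ y∈⁅x⁆ = ⊥-elim (x∉q (subst (_∈ q) (x∈⁅y⁆⇒x≡y x y∈⁅x⁆) y∈q))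
  grow : p ∩ q ⊆ (p ∪ ⁅ x ⁆) ∩ q
  grow h = let y∈p , y∈q = x∈p∩q⁻ p q h in x∈p∩q⁺ (p⊆p∪q ⁅ x ⁆ y∈p , y∈q)

∪⁅⁆-∩-∈ : ∀ (p : Subset n) → x ∈ q → (p ∪ ⁅ x ⁆) ∩ q ≡ (p ∩ q) ∪ ⁅ x ⁆
∪⁅⁆-∩-∈ {x = x} {q} p x∈q = ⊆-antisym shrink grow
  where
  shrink : (p ∪ ⁅ x ⁆) ∩ q ⊆ (p ∩ q) ∪ ⁅ x ⁆
  shrink h with x∈p∩q⁻ _ q h
  ... | y∈ , y∈q with x∈p∪q⁻ p ⁅ x ⁆ y∈
  ... | inj₁ y∈p   = p⊆p∪q ⁅ x ⁆ (x∈p∩q⁺ (y∈p , y∈q))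
  ... | inj₂ y∈⁅x⁆ = q⊆p∪q (p ∩ q) ⁅ x ⁆ y∈⁅x⁆
  grow : (p ∩ q) ∪ ⁅ x ⁆ ⊆ (p ∪ ⁅ x ⁆) ∩ q
  grow h with x∈p∪q⁻ (p ∩ q) ⁅ x ⁆ h
  ... | inj₁ y∈p∩q = let y∈p , y∈q = x∈p∩q⁻ p q y∈p∩q in x∈p∩q⁺ (p⊆p∪q ⁅ x ⁆ y∈p , y∈q)
  ... | inj₂ y∈⁅x⁆ = x∈p∩q⁺ (q⊆p∪q p ⁅ x ⁆ y∈⁅x⁆ , x∈p⇒⁅x⁆⊆p x∈q y∈⁅x⁆)

∪⁅⁆-─-∈ : ∀ (p : Subset n) → x ∈ q → (p ∪ ⁅ x ⁆) ─ q ≡ p ─ q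
∪⁅⁆-─-∈ {x = x} {q} p x∈q = ⊆-antisym shrink grow
  where
  shrink : (p ∪ ⁅ x ⁆) ─ q ⊆ p ─ q
  shrink h with x∈p∪q⁻ p ⁅ x ⁆ (p─q⊆p _ q h)
  ... | inj₁ y∈p   = x∈p∧x∉q⇒x∈p─q y∈p (x∈p─q⇒x∉q _ q h)
  ... | inj₂ y∈⁅x⁆ = ⊥-elim (x∈p─q⇒x∉q _ q h (x∈p⇒⁅x⁆⊆p x∈q y∈⁅x⁆))
  grow : p ─ q ⊆ (p ∪ ⁅ x ⁆) ─ q
  grow h = x∈p∧x∉q⇒x∈p─q (p⊆p∪q ⁅ x ⁆ (p─q⊆p p q h)) (x∈p─q⇒x∉q p q h)

∪⁅⁆-─-∉ : ∀ (p : Subset n) → x ∉ q → (p ∪ ⁅ x ⁆) ─ q ≡ (p ─ q) ∪ ⁅ x ⁆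
∪⁅⁆-─-∉ {x = x} {q} p x∉q = ⊆-antisym shrink grow
  where
  shrink : (p ∪ ⁅ x ⁆) ─ q ⊆ (p ─ q) ∪ ⁅ x ⁆
  shrink h with x∈p∪q⁻ p ⁅ x ⁆ (p─q⊆p _ q h)
  ... | inj₁ y∈p   = p⊆p∪q ⁅ x ⁆ (x∈p∧x∉q⇒x∈p─q y∈p (x∈p─q⇒x∉q _ q h))
  ... | inj₂ y∈⁅x⁆ = q⊆p∪q (p ─ q) ⁅ x ⁆ y∈⁅x⁆
  grow : (p ─ q) ∪ ⁅ x ⁆ ⊆ (p ∪ ⁅ x ⁆) ─ q
  grow h with x∈p∪q⁻ (p ─ q) ⁅ x ⁆ h
  ... | inj₁ y∈p─q = x∈p∧x∉q⇒x∈p─q (p⊆p∪q ⁅ x ⁆ (p─q⊆p p q y∈p─q)) (x∈p─q⇒x∉q p q y∈p─q)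
  ... | inj₂ y∈⁅x⁆ = x∈p∧x∉q⇒x∈p─q (q⊆p∪q p ⁅ x ⁆ y∈⁅x⁆)
                       (λ y∈q → x∉q (subst (_∈ q) (x∈⁅y⁆⇒x≡y x y∈⁅x⁆) y∈q))

p─[p∩q]≡p─q : ∀ (p q : Subset n) → p ─ (p ∩ q) ≡ p ─ q
p─[p∩q]≡p─q p q = ⊆-antisym shrink grow
  where
  shrink : p ─ (p ∩ q) ⊆ p ─ q
  shrink h = x∈p∧x∉q⇒x∈p─q (p─q⊆p p _ h) (λ y∈q → x∈p─q⇒x∉q p _ h (x∈p∩q⁺ (p─q⊆p p _ h , y∈q)))
  grow : p ─ q ⊆ p ─ (p ∩ q)
  grow h = x∈p∧x∉q⇒x∈p─q (p─q⊆p p q h) (λ y∈p∩q → x∈p─q⇒x∉q p q h (proj₂ (x∈p∩q⁻ p q y∈p∩q)))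

[s∩q]∪[p─q]≡s : p ─ q ⊆ s → s ⊆ p → (s ∩ q) ∪ (p ─ q) ≡ s
[s∩q]∪[p─q]≡s {p = p} {q} {s} p─q⊆s s⊆p = ⊆-antisym (∪-least (p∩q⊆p s q) p─q⊆s) grow
  where
  grow : s ⊆ (s ∩ q) ∪ (p ─ q)
  grow {y} y∈s with y ∈? q
  ... | yes y∈q = p⊆p∪q (p ─ q) (x∈p∩q⁺ (y∈s , y∈q))
  ... | no  y∉q = q⊆p∪q (s ∩ q) (p ─ q) (x∈p∧x∉q⇒x∈p─q (s⊆p y∈s) y∉q)

∣p∪⁅x⁆∣≡1+∣p∣ : ∀ (p : Subset n) → x ∉ p → ∣ p ∪ ⁅ x ⁆ ∣ ≡ suc ∣ p ∣
∣p∪⁅x⁆∣≡1+∣p∣ {x = zero}  (outside ∷ p) _   = cong suc (cong ∣_∣ (∪-identityʳ p))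
∣p∪⁅x⁆∣≡1+∣p∣ {x = zero}  (inside ∷ p)  x∉p = ⊥-elim (x∉p here)
∣p∪⁅x⁆∣≡1+∣p∣ {x = suc x} (outside ∷ p) x∉p = ∣p∪⁅x⁆∣≡1+∣p∣ p (x∉p ∘ there)
∣p∪⁅x⁆∣≡1+∣p∣ {x = suc x} (inside ∷ p)  x∉p = cong suc (∣p∪⁅x⁆∣≡1+∣p∣ p (x∉p ∘ there))

∣p∣≡∣p∩q∣+∣p─q∣ : ∀ (p q : Subset n) → ∣ p ∣ ≡ ∣ p ∩ q ∣ + ∣ p ─ q ∣
∣p∣≡∣p∩q∣+∣p─q∣ []            []            = refl
∣p∣≡∣p∩q∣+∣p─q∣ (outside ∷ p) (inside ∷ q)  = ∣p∣≡∣p∩q∣+∣p─q∣ p q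
∣p∣≡∣p∩q∣+∣p─q∣ (outside ∷ p) (outside ∷ q) = ∣p∣≡∣p∩q∣+∣p─q∣ p q
∣p∣≡∣p∩q∣+∣p─q∣ (inside ∷ p)  (inside ∷ q)  = cong suc (∣p∣≡∣p∩q∣+∣p─q∣ p q)
∣p∣≡∣p∩q∣+∣p─q∣ (inside ∷ p)  (outside ∷ q) = trans (cong suc (∣p∣≡∣p∩q∣+∣p─q∣ p q)) (sym (+-suc _ _))

∪⁅⁆-induction : (P : Pred (Subset n) 0ℓ) → P ⊥ → (∀ s x → x ∉ s → P s → P (s ∪ ⁅ x ⁆)) → ∀ s → P s
∪⁅⁆-induction {zero}  P P⊥ step [] = P⊥
∪⁅⁆-induction {suc n} P P⊥ step (outside ∷ s) =
  ∪⁅⁆-induction (λ s → P (outside ∷ s)) P⊥ (λ s x x∉s → step (outside ∷ s) (suc x) (x∉s ∘ drop-there)) s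
∪⁅⁆-induction {suc n} P P⊥ step (inside ∷ s) =
  ∪⁅⁆-induction (λ s → P (inside ∷ s)) P⁅zero⁆ (λ s x x∉s → step (inside ∷ s) (suc x) (x∉s ∘ drop-there)) s
  where
  P⁅zero⁆ : P (inside ∷ ⊥)
  P⁅zero⁆ = subst (λ s → P (inside ∷ s)) (∪-identityʳ ⊥) (step ⊥ zero ∉⊥ P⊥)

filterᶠ : {P : Pred (Fin n) 0ℓ} → Decidable P → Subset n
filterᶠ P? = tabulate (λ x → isYes (P? x))

∈-filterᶠ⁻ : {P : Pred (Fin n) 0ℓ} (P? : Decidable P) → x ∈ filterᶠ P? → P x
∈-filterᶠ⁻ {x = x} P? h with P? x | trans (sym (lookup∘tabulate _ x)) ([]=⇒lookup h)
... | yes Px | _  = Px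
... | no  _  | ()

∈-filterᶠ⁺ : {P : Pred (Fin n) 0ℓ} (P? : Decidable P) → P x → x ∈ filterᶠ P?
∈-filterᶠ⁺ {x = x} P? Px with P? x in eq
... | yes _  = lookup⇒[]= x _ (trans (lookup∘tabulate _ x) (cong isYes eq))
... | no ¬Px = ⊥-elim (¬Px Px)

-- Matroids

Spans : {E : Subset n} → Matroid E → Subset n → Fin n → Set
Spans M Y x = r M (Y ∪ ⁅ x ⁆) ≤ r M Y

module _ {E : Subset n} (M : Matroid E) where

  r-⊥ : r M ⊥ ≡ 0
  r-⊥ = n≤0⇒n≡0 (≤-trans (r-card M ⊥ (⊆-min E)) (≤-reflexive (∣⊥∣≡0 n)))

  r-∪⁅⁆-mono : ∀ {Y x} → Y ⊆ E → x ∈ E → r M Y ≤ r M (Y ∪ ⁅ x ⁆)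
  r-∪⁅⁆-mono {Y} {x} Y⊆E x∈E = r-mono M Y _ (p⊆p∪q ⁅ x ⁆) (∪-least Y⊆E (x∈p⇒⁅x⁆⊆p x∈E))

  r-∪⁅⁆≤1+r : ∀ {Y x} → Y ⊆ E → x ∈ E → r M (Y ∪ ⁅ x ⁆) ≤ suc (r M Y)
  r-∪⁅⁆≤1+r {Y} {x} Y⊆E x∈E = begin
    r M (Y ∪ ⁅ x ⁆)                      ≤⟨ m≤m+n _ _ ⟩
    r M (Y ∪ ⁅ x ⁆) + r M (Y ∩ ⁅ x ⁆)    ≤⟨ r-sub M Y ⁅ x ⁆ Y⊆E (x∈p⇒⁅x⁆⊆p x∈E) ⟩
    r M Y + r M ⁅ x ⁆                    ≤⟨ +-monoʳ-≤ (r M Y) (r-card M ⁅ x ⁆ (x∈p⇒⁅x⁆⊆p x∈E)) ⟩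
    r M Y + ∣ ⁅ x ⁆ ∣                    ≡⟨ cong (r M Y +_) (∣⁅x⁆∣≡1 x) ⟩
    r M Y + 1                            ≡⟨ +-comm (r M Y) 1 ⟩
    suc (r M Y)                          ∎
    where open ≤-Reasoning

  r-absorb : ∀ {P Q R} → P ⊆ E → Q ⊆ E → R ⊆ P → R ⊆ Q → r M Q ≤ r M R → r M (P ∪ Q) ≤ r M P
  r-absorb {P} {Q} {R} P⊆E Q⊆E R⊆P R⊆Q rQ≤rR = +-cancelʳ-≤ (r M R) _ _ (begin
    r M (P ∪ Q) + r M R        ≤⟨ +-monoʳ-≤ _ (r-mono M R (P ∩ Q) (λ h → x∈p∩q⁺ (R⊆P h , R⊆Q h)) (⊆-trans (p∩q⊆p P Q) P⊆E)) ⟩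
    r M (P ∪ Q) + r M (P ∩ Q)  ≤⟨ r-sub M P Q P⊆E Q⊆E ⟩
    r M P + r M Q              ≤⟨ +-monoʳ-≤ (r M P) rQ≤rR ⟩
    r M P + r M R              ∎)
    where open ≤-Reasoning

  Spans-mono : ∀ {Y Z x} → Y ⊆ Z → Z ⊆ E → x ∈ E → Spans M Y x → Spans M Z x
  Spans-mono {Y} {Z} {x} Y⊆Z Z⊆E x∈E spans = begin
    r M (Z ∪ ⁅ x ⁆)          ≤⟨ r-mono M _ _ (∪-least (p⊆p∪q _) (q⊆p∪q Z _ ∘ q⊆p∪q Y ⁅ x ⁆)) (∪-least Z⊆E Yx⊆E) ⟩
    r M (Z ∪ (Y ∪ ⁅ x ⁆))    ≤⟨ r-absorb Z⊆E Yx⊆E Y⊆Z (p⊆p∪q ⁅ x ⁆) spans ⟩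
    r M Z                    ∎
    where
    open ≤-Reasoning
    Yx⊆E : Y ∪ ⁅ x ⁆ ⊆ E
    Yx⊆E = ∪-least (⊆-trans Y⊆Z Z⊆E) (x∈p⇒⁅x⁆⊆p x∈E)

  r-∪-spanned : ∀ {Y} → Y ⊆ E → ∀ S → S ⊆ E → (∀ {x} → x ∈ S → Spans M Y x) → r M (Y ∪ S) ≤ r M Y
  r-∪-spanned {Y} Y⊆E = ∪⁅⁆-induction Absorbed base step
    where
    Absorbed : Pred (Subset n) 0ℓ
    Absorbed S = S ⊆ E → (∀ {x} → x ∈ S → Spans M Y x) → r M (Y ∪ S) ≤ r M Y
    base : Absorbed ⊥
    base _ _ = ≤-reflexive (cong (r M) (∪-identityʳ Y))
    step : ∀ S x → x ∉ S → Absorbed S → Absorbed (S ∪ ⁅ x ⁆)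
    step S x _ ih Sx⊆E spanned = begin
      r M (Y ∪ (S ∪ ⁅ x ⁆))    ≡⟨ cong (r M) (sym (∪-assoc Y S ⁅ x ⁆)) ⟩
      r M ((Y ∪ S) ∪ ⁅ x ⁆)    ≤⟨ Spans-mono (p⊆p∪q S) (∪-least Y⊆E S⊆E) (Sx⊆E x∈Sx) (spanned x∈Sx) ⟩
      r M (Y ∪ S)              ≤⟨ ih S⊆E (spanned ∘ p⊆p∪q ⁅ x ⁆) ⟩
      r M Y                    ∎
      where
      open ≤-Reasoning
      x∈Sx : x ∈ S ∪ ⁅ x ⁆
      x∈Sx = q⊆p∪q S ⁅ x ⁆ (x∈⁅x⁆ x)
      S⊆E : S ⊆ E
      S⊆E = Sx⊆E ∘ p⊆p∪q ⁅ x ⁆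

  closure : Subset n → Subset n
  closure Y = filterᶠ (λ x → (x ∈? E) ×-dec (r M (Y ∪ ⁅ x ⁆) ≤? r M Y))

  closure⊆E : ∀ Y → closure Y ⊆ E
  closure⊆E Y = proj₁ ∘ ∈-filterᶠ⁻ _

  ⊆closure : ∀ {Y} → Y ⊆ E → Y ⊆ closure Y
  ⊆closure {Y} Y⊆E {x} x∈Y =
    ∈-filterᶠ⁺ _ (Y⊆E x∈Y , ≤-reflexive (cong (r M) (trans (∪-comm Y ⁅ x ⁆) (p⊆q⇒p∪q≡q (x∈p⇒⁅x⁆⊆p x∈Y)))))

  r-closure : ∀ {Y} → Y ⊆ E → r M (closure Y) ≤ r M Y
  r-closure {Y} Y⊆E = ≤-trans (r-mono M _ _ (q⊆p∪q Y _) (∪-least Y⊆E (closure⊆E Y)))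
                              (r-∪-spanned Y⊆E (closure Y) (closure⊆E Y) (proj₂ ∘ ∈-filterᶠ⁻ _))

  closure-flat : ∀ {Y} → Y ⊆ E → Flat (sys M) (closure Y)
  closure-flat {Y} Y⊆E = closure⊆E Y , λ x x∈E x∉cl → begin-strict
    r M (closure Y)             ≤⟨ r-closure Y⊆E ⟩
    r M Y                       <⟨ ≰⇒> (λ spans → x∉cl (∈-filterᶠ⁺ _ (x∈E , spans))) ⟩
    r M (Y ∪ ⁅ x ⁆)             ≤⟨ r-mono M _ _ (∪-least (p⊆p∪q ⁅ x ⁆ ∘ ⊆closure Y⊆E) (q⊆p∪q _ ⁅ x ⁆))
                                               (∪-least (closure⊆E Y) (x∈p⇒⁅x⁆⊆p x∈E)) ⟩
    r M (closure Y ∪ ⁅ x ⁆)     ∎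
    where open ≤-Reasoning

  basis : ∀ Y → Y ⊆ E → Σ[ I ∈ Subset n ] I ⊆ Y × r M I ≡ ∣ I ∣ × r M I ≡ r M Y
  basis = ∪⁅⁆-induction HasBasis base step
    where
    HasBasis : Pred (Subset n) 0ℓ
    HasBasis Y = Y ⊆ E → Σ[ I ∈ Subset n ] I ⊆ Y × r M I ≡ ∣ I ∣ × r M I ≡ r M Y
    base : HasBasis ⊥
    base _ = ⊥ , ⊆-refl , trans r-⊥ (sym (∣⊥∣≡0 n)) , refl
    step : ∀ S x → x ∉ S → HasBasis S → HasBasis (S ∪ ⁅ x ⁆)
    step S x x∉S hasBasis Sx⊆E with hasBasis (Sx⊆E ∘ p⊆p∪q ⁅ x ⁆) | r M (S ∪ ⁅ x ⁆) ≤? r M S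
    ... | I , I⊆S , rI≡∣I∣ , rI≡rS | yes spans =
      I , p⊆p∪q ⁅ x ⁆ ∘ I⊆S , rI≡∣I∣ ,
      trans rI≡rS (≤-antisym (r-∪⁅⁆-mono (Sx⊆E ∘ p⊆p∪q ⁅ x ⁆) x∈E) spans)
      where
      x∈E : x ∈ E
      x∈E = Sx⊆E (q⊆p∪q S ⁅ x ⁆ (x∈⁅x⁆ x))
    ... | I , I⊆S , rI≡∣I∣ , rI≡rS | no ¬spans =
      I ∪ ⁅ x ⁆ , Ix⊆Sx , ≤-antisym (r-card M _ Ix⊆E) (≤-trans ∣Ix∣≤rSx rSx≤rIx) ,
      ≤-antisym (≤-trans (r-card M _ Ix⊆E) ∣Ix∣≤rSx) rSx≤rIx
      where
      S⊆E : S ⊆ E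
      S⊆E = Sx⊆E ∘ p⊆p∪q ⁅ x ⁆
      Ix⊆Sx : I ∪ ⁅ x ⁆ ⊆ S ∪ ⁅ x ⁆
      Ix⊆Sx = ∪-least (p⊆p∪q ⁅ x ⁆ ∘ I⊆S) (q⊆p∪q S ⁅ x ⁆)
      Ix⊆E : I ∪ ⁅ x ⁆ ⊆ E
      Ix⊆E = Sx⊆E ∘ Ix⊆Sx
      ∣Ix∣≤rSx : ∣ I ∪ ⁅ x ⁆ ∣ ≤ r M (S ∪ ⁅ x ⁆)
      ∣Ix∣≤rSx = begin
        ∣ I ∪ ⁅ x ⁆ ∣     ≡⟨ ∣p∪⁅x⁆∣≡1+∣p∣ I (x∉S ∘ I⊆S) ⟩
        suc ∣ I ∣         ≡⟨ cong suc (trans (sym rI≡∣I∣) rI≡rS) ⟩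
        suc (r M S)       ≤⟨ ≰⇒> ¬spans ⟩
        r M (S ∪ ⁅ x ⁆)   ∎
        where open ≤-Reasoning
      rSx≤rIx : r M (S ∪ ⁅ x ⁆) ≤ r M (I ∪ ⁅ x ⁆)
      rSx≤rIx = begin
        r M (S ∪ ⁅ x ⁆)             ≤⟨ r-mono M _ _ (∪-least (q⊆p∪q (I ∪ ⁅ x ⁆) S) (p⊆p∪q S ∘ q⊆p∪q I ⁅ x ⁆))
                                                     (∪-least Ix⊆E S⊆E) ⟩
        r M ((I ∪ ⁅ x ⁆) ∪ S)       ≤⟨ r-absorb Ix⊆E S⊆E (p⊆p∪q ⁅ x ⁆) I⊆S (≤-reflexive (sym rI≡rS)) ⟩
        r M (I ∪ ⁅ x ⁆)             ∎
        where open ≤-Reasoning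

-- Weak and strong order

module _ {E : Subset n} (M P : Matroid E) where

  ≤w⇒r≤ : sys M ≤w sys P → ∀ {Y} → Y ⊆ E → r M Y ≤ r P Y
  ≤w⇒r≤ (_ , indep⇒indep) {Y} Y⊆E with basis M Y Y⊆E
  ... | I , I⊆Y , rI≡∣I∣ , rI≡rY = begin
    r M Y    ≡⟨ sym rI≡rY ⟩
    r M I    ≡⟨ rI≡∣I∣ ⟩
    ∣ I ∣    ≡⟨ sym (proj₂ (indep⇒indep I (⊆-trans I⊆Y Y⊆E , rI≡∣I∣))) ⟩
    r P I    ≤⟨ r-mono P I Y I⊆Y Y⊆E ⟩
    r P Y    ∎
    where open ≤-Reasoning

  -- closure M Y is a flat of M avoiding x, hence a flat of P, and it cannot be a flat of P if P spans x from Y.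
  ⊴⇒r-∪⁅⁆-< : sys M ⊴ sys P → ∀ {Y x} → Y ⊆ E → x ∈ E →
              r M Y < r M (Y ∪ ⁅ x ⁆) → r P Y < r P (Y ∪ ⁅ x ⁆)
  ⊴⇒r-∪⁅⁆-< (_ , flat⇒flat) {Y} {x} Y⊆E x∈E increase = ≰⇒> λ spansᴾ →
    <⇒≱ (proj₂ (flat⇒flat _ (closure-flat M Y⊆E)) x x∈E x∉closure)
        (Spans-mono P (⊆closure M Y⊆E) (closure⊆E M Y) x∈E spansᴾ)
    where
    x∉closure : x ∉ closure M Y
    x∉closure = <⇒≱ increase ∘ proj₂ ∘ ∈-filterᶠ⁻ _

  ⊴⇒r-gap-∪⁅⁆ : sys M ⊴ sys P → ∀ {Y x} → Y ⊆ E → x ∈ E →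
                r M (Y ∪ ⁅ x ⁆) + r P Y ≤ r M Y + r P (Y ∪ ⁅ x ⁆)
  ⊴⇒r-gap-∪⁅⁆ M⊴P {Y} {x} Y⊆E x∈E with r M (Y ∪ ⁅ x ⁆) ≤? r M Y
  ... | yes spans = +-mono-≤ spans (r-∪⁅⁆-mono P Y⊆E x∈E)
  ... | no ¬spans = begin
    r M (Y ∪ ⁅ x ⁆) + r P Y    ≤⟨ +-monoˡ-≤ (r P Y) (r-∪⁅⁆≤1+r M Y⊆E x∈E) ⟩
    suc (r M Y) + r P Y        ≡⟨ sym (+-suc (r M Y) (r P Y)) ⟩
    r M Y + suc (r P Y)        ≤⟨ +-monoʳ-≤ (r M Y) (⊴⇒r-∪⁅⁆-< M⊴P Y⊆E x∈E (≰⇒> ¬spans)) ⟩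
    r M Y + r P (Y ∪ ⁅ x ⁆)    ∎
    where open ≤-Reasoning

  ⊴⇒r-gap-mono : sys M ⊴ sys P → ∀ {Y Z} → Y ⊆ Z → Z ⊆ E → r P Y + r M Z ≤ r M Y + r P Z
  ⊴⇒r-gap-mono M⊴P {Y} {Z} Y⊆Z Z⊆E =
    subst (λ Z → r P Y + r M Z ≤ r M Y + r P Z) (p⊆q⇒p∪q≡q Y⊆Z) (∪⁅⁆-induction GapBound base step Z Z⊆E)
    where
    Y⊆E : Y ⊆ E
    Y⊆E = ⊆-trans Y⊆Z Z⊆E
    GapBound : Pred (Subset n) 0ℓ
    GapBound W = W ⊆ E → r P Y + r M (Y ∪ W) ≤ r M Y + r P (Y ∪ W)
    base : GapBound ⊥
    base _ rewrite ∪-identityʳ Y = ≤-reflexive (+-comm (r P Y) (r M Y))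
    chain : ∀ a b c d b' d' → a + b ≤ c + d → b' + d ≤ b + d' → a + b' ≤ c + d'
    chain a b c d b' d' ab≤cd b'd≤bd' = +-cancelʳ-≤ (b + d) _ _ (begin
      (a + b') + (b + d)    ≡⟨ +-interchange a b' b d ⟩
      (a + b) + (b' + d)    ≤⟨ +-mono-≤ ab≤cd b'd≤bd' ⟩
      (c + d) + (b + d')    ≡⟨ +-interchange c d b d' ⟩
      (c + b) + (d + d')    ≡⟨ cong ((c + b) +_) (+-comm d d') ⟩
      (c + b) + (d' + d)    ≡⟨ +-interchange c b d' d ⟩
      (c + d') + (b + d)    ∎)
      where open ≤-Reasoning
    step : ∀ S x → x ∉ S → GapBound S → GapBound (S ∪ ⁅ x ⁆)
    step S x _ gapBound Sx⊆E rewrite sym (∪-assoc Y S ⁅ x ⁆) =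
      chain (r P Y) (r M (Y ∪ S)) (r M Y) (r P (Y ∪ S)) (r M ((Y ∪ S) ∪ ⁅ x ⁆)) (r P ((Y ∪ S) ∪ ⁅ x ⁆))
        (gapBound (Sx⊆E ∘ p⊆p∪q ⁅ x ⁆))
        (⊴⇒r-gap-∪⁅⁆ M⊴P (∪-least Y⊆E (Sx⊆E ∘ p⊆p∪q ⁅ x ⁆)) (Sx⊆E (q⊆p∪q S ⁅ x ⁆ (x∈⁅x⁆ x))))

  ⊴⇒r≤ : sys M ⊴ sys P → ∀ {Y} → Y ⊆ E → r M Y ≤ r P Y
  ⊴⇒r≤ M⊴P {Y} Y⊆E with ⊴⇒r-gap-mono M⊴P (⊆-min Y) Y⊆E
  ... | gap rewrite r-⊥ M | r-⊥ P = gap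

-- Free splice

⊓-<-⊓ : ∀ {m n m' n'} → (m ≤ n → m < m') → (n ≤ m → n < n') → m ≤ m' → n ≤ n' → m ⊓ n < m' ⊓ n'
⊓-<-⊓ {m} {n} {m'} {n'} m<m' n<n' m≤m' n≤n' = ⊓-glb below-m' below-n'
  where
  below-m' : m ⊓ n < m'
  below-m' with m ≤? n
  ... | yes m≤n = ≤-<-trans (m⊓n≤m m n) (m<m' m≤n)
  ... | no  m≰n = ≤-<-trans (m⊓n≤n m n) (<-≤-trans (≰⇒> m≰n) m≤m')
  below-n' : m ⊓ n < n'
  below-n' with n ≤? m
  ... | yes n≤m = ≤-<-trans (m⊓n≤n m n) (n<n' n≤m)
  ... | no  n≰m = ≤-<-trans (m⊓n≤m m n) (<-≤-trans (≰⇒> n≰m) n≤n')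

⊓<⊓⇒<ˡ : ∀ {m n m' n'} → m ≤ n → m ⊓ n < m' ⊓ n' → m < m'
⊓<⊓⇒<ˡ {m} {n} {m'} {n'} m≤n lt = <-≤-trans (subst (_< m' ⊓ n') (m≤n⇒m⊓n≡m m≤n) lt) (m⊓n≤m m' n')

⊓<⊓⇒<ʳ : ∀ {m n m' n'} → n ≤ m → m ⊓ n < m' ⊓ n' → n < n'
⊓<⊓⇒<ʳ {m} {n} {m'} {n'} n≤m lt = <-≤-trans (subst (_< m' ⊓ n') (m≥n⇒m⊓n≡n n≤m) lt) (m⊓n≤n m' n')

module _ {A B : Subset n} where

  ρ₁ : Matroid A → Subset n → ℕ
  ρ₁ M X = r M (X ∩ A) + ∣ X ─ A ∣

  ρ₂ : Matroid A → Matroid B → Subset n → ℕ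
  ρ₂ M N X = r N (X ∩ B) + r M (A ─ B)

  private
    ∩-∪⁅⁆ : ∀ X e (C : Subset n) → X ∩ C ⊆ (X ∪ ⁅ e ⁆) ∩ C
    ∩-∪⁅⁆ X e C h = let h₁ , h₂ = x∈p∩q⁻ X C h in x∈p∩q⁺ (p⊆p∪q ⁅ e ⁆ h₁ , h₂)

  ρ₁-∪⁅⁆-mono : ∀ (M : Matroid A) X e → ρ₁ M X ≤ ρ₁ M (X ∪ ⁅ e ⁆)
  ρ₁-∪⁅⁆-mono M X e = +-mono-≤ (r-mono M _ _ (∩-∪⁅⁆ X e A) (p∩q⊆q _ A)) (p⊆q⇒∣p∣≤∣q∣ ─-grows)
    where
    ─-grows : X ─ A ⊆ (X ∪ ⁅ e ⁆) ─ A
    ─-grows h = x∈p∧x∉q⇒x∈p─q (p⊆p∪q ⁅ e ⁆ (p─q⊆p X A h)) (x∈p─q⇒x∉q X A h)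

  ρ₂-∪⁅⁆-mono : ∀ (M : Matroid A) (N : Matroid B) X e → ρ₂ M N X ≤ ρ₂ M N (X ∪ ⁅ e ⁆)
  ρ₂-∪⁅⁆-mono M N X e = +-monoˡ-≤ (r M (A ─ B)) (r-mono N _ _ (∩-∪⁅⁆ X e B) (p∩q⊆q _ B))

  ρ₁≤∣∣ : ∀ (M : Matroid A) X → ρ₁ M X ≤ ∣ X ∣
  ρ₁≤∣∣ M X = ≤-trans (+-monoˡ-≤ ∣ X ─ A ∣ (r-card M (X ∩ A) (p∩q⊆q X A))) (≤-reflexive (sym (∣p∣≡∣p∩q∣+∣p─q∣ X A)))

  ρ₂-<⇒r-< : ∀ (M : Matroid A) (N : Matroid B) {X e} → ρ₂ M N X < ρ₂ M N (X ∪ ⁅ e ⁆) →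
             Σ[ e∈B ∈ e ∈ B ] r N (X ∩ B) < r N ((X ∩ B) ∪ ⁅ e ⁆)
  ρ₂-<⇒r-< M N {X} {e} increase with e ∈? B
  ... | yes e∈B rewrite ∪⁅⁆-∩-∈ X e∈B = e∈B , +-cancelʳ-< (r M (A ─ B)) _ _ increase
  ... | no  e∉B rewrite ∪⁅⁆-∩-∉ X e∉B = ⊥-elim (<-irrefl refl increase)

  matched-rank : ∀ (M : Matroid A) (N : Matroid B) → Matched M N → ∀ {S} → S ⊆ A → A ─ B ⊆ S →
                 r M S ≡ r N (S ∩ B) + r M (A ─ B)
  matched-rank M N (_ , match) {S} S⊆A A─B⊆S = begin
    r M S                                                ≡⟨ cong (r M) (sym S≡) ⟩
    r M ((S ∩ B) ∪ (A ─ B))                              ≡⟨ sym (m∸n+n≡m (r-mono M _ _ (q⊆p∪q (S ∩ B) _) (subst (_⊆ A) (sym S≡) S⊆A))) ⟩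
    r M ((S ∩ B) ∪ (A ─ B)) ∸ r M (A ─ B) + r M (A ─ B)  ≡⟨ cong (λ D → r M ((S ∩ B) ∪ D) ∸ r M D + r M (A ─ B)) (sym (p─[p∩q]≡p─q A B)) ⟩
    r M ((S ∩ B) ∪ (A ─ (A ∩ B))) ∸ r M (A ─ (A ∩ B)) + r M (A ─ B)
                                                         ≡⟨ cong (_+ r M (A ─ B)) (match (S ∩ B) S∩B⊆A∩B) ⟩
    r N (S ∩ B) + r M (A ─ B)                            ∎
    where
    open ≡-Reasoning
    S≡ : (S ∩ B) ∪ (A ─ B) ≡ S
    S≡ = [s∩q]∪[p─q]≡s A─B⊆S S⊆A
    S∩B⊆A∩B : S ∩ B ⊆ A ∩ B
    S∩B⊆A∩B h = let h₁ , h₂ = x∈p∩q⁻ S B h in x∈p∩q⁺ (S⊆A h₁ , h₂)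

  matched-Spans : ∀ (M : Matroid A) (N : Matroid B) → Matched M N → ∀ {S e} → S ⊆ A → A ─ B ⊆ S →
                  e ∈ A → e ∈ B → Spans M S e → Spans N (S ∩ B) e
  matched-Spans M N matched {S} {e} S⊆A A─B⊆S e∈A e∈B spans = +-cancelʳ-≤ (r M (A ─ B)) _ _ (begin
    r N ((S ∩ B) ∪ ⁅ e ⁆) + r M (A ─ B)   ≡⟨ cong (λ T → r N T + r M (A ─ B)) (sym (∪⁅⁆-∩-∈ S e∈B)) ⟩
    r N ((S ∪ ⁅ e ⁆) ∩ B) + r M (A ─ B)   ≡⟨ sym (matched-rank M N matched (∪-least S⊆A (x∈p⇒⁅x⁆⊆p e∈A)) (p⊆p∪q ⁅ e ⁆ ∘ A─B⊆S)) ⟩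
    r M (S ∪ ⁅ e ⁆)                       ≤⟨ spans ⟩
    r M S                                 ≡⟨ matched-rank M N matched S⊆A A─B⊆S ⟩
    r N (S ∩ B) + r M (A ─ B)             ∎)
    where open ≤-Reasoning

  ⋈-flat⇒A─B⊆ : ∀ (M : Matroid A) (N : Matroid B) {X} → Flat (M ⋈ N) X → ρ₂ M N X < ρ₁ M X → A ─ B ⊆ X
  ⋈-flat⇒A─B⊆ M N {X} (_ , flat) ρ₂<ρ₁ {e} e∈A─B with e ∈? X
  ... | yes e∈X = e∈X
  ... | no  e∉X = ⊥-elim (x∈p─q⇒x∉q A B e∈A─B (proj₁ (ρ₂-<⇒r-< M N ρ₂-grows)))
    where
    ρ₂-grows : ρ₂ M N X < ρ₂ M N (X ∪ ⁅ e ⁆)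
    ρ₂-grows = ⊓<⊓⇒<ʳ (<⇒≤ ρ₂<ρ₁) (flat e (p⊆p∪q B (p─q⊆p A B e∈A─B)) e∉X)

  ⋈-flat⇒ρ₁-< : ∀ (M : Matroid A) (N : Matroid B) → Matched M N → ∀ {X} → Flat (M ⋈ N) X →
                ∀ {e} → e ∈ A ∪ B → e ∉ X → ρ₁ M X < ρ₁ M (X ∪ ⁅ e ⁆)
  ⋈-flat⇒ρ₁-< M N matched {X} (X⊆A∪B , flat) {e} e∈A∪B e∉X with ρ₁ M X ≤? ρ₂ M N X
  ... | yes ρ₁≤ρ₂ = ⊓<⊓⇒<ˡ ρ₁≤ρ₂ (flat e e∈A∪B e∉X)
  ... | no  ρ₁≰ρ₂ with e ∈? A
  ...   | no  e∉A rewrite ∪⁅⁆-∩-∉ X e∉A | ∪⁅⁆-─-∉ X e∉A | ∣p∪⁅x⁆∣≡1+∣p∣ (X ─ A) (e∉X ∘ p─q⊆p X A) =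
    ≤-reflexive (sym (+-suc (r M (X ∩ A)) ∣ X ─ A ∣))
  ...   | yes e∈A rewrite ∪⁅⁆-∩-∈ X e∈A | ∪⁅⁆-─-∈ X e∈A = +-monoˡ-< ∣ X ─ A ∣ (≰⇒> ¬spans)
    where
    ρ₂<ρ₁ : ρ₂ M N X < ρ₁ M X
    ρ₂<ρ₁ = ≰⇒> ρ₁≰ρ₂
    A─B⊆X∩A : A ─ B ⊆ X ∩ A
    A─B⊆X∩A h = x∈p∩q⁺ (⋈-flat⇒A─B⊆ M N (X⊆A∪B , flat) ρ₂<ρ₁ h , p─q⊆p A B h)
    X∩A∩B⊆X∩B : (X ∩ A) ∩ B ⊆ X ∩ B
    X∩A∩B⊆X∩B h = let h₁ , h₂ = x∈p∩q⁻ (X ∩ A) B h in x∈p∩q⁺ (p∩q⊆p X A h₁ , h₂)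
    ¬spans : ¬ Spans M (X ∩ A) e
    ¬spans spans with ρ₂-<⇒r-< M N (⊓<⊓⇒<ʳ (<⇒≤ ρ₂<ρ₁) (flat e e∈A∪B e∉X))
    ... | e∈B , increase = <⇒≱ increase
      (Spans-mono N X∩A∩B⊆X∩B (p∩q⊆q X B) e∈B (matched-Spans M N matched (p∩q⊆q X A) A─B⊆X∩A e∈A e∈B spans))

  ⊴⇒ρ₁-< : ∀ (M M' : Matroid A) → sys M ⊴ sys M' → ∀ {X e} →
           ρ₁ M X < ρ₁ M (X ∪ ⁅ e ⁆) → ρ₁ M' X < ρ₁ M' (X ∪ ⁅ e ⁆)
  ⊴⇒ρ₁-< M M' M⊴M' {X} {e} increase with e ∈? A
  ... | yes e∈A rewrite ∪⁅⁆-∩-∈ X e∈A | ∪⁅⁆-─-∈ X e∈A =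
    +-monoˡ-< ∣ X ─ A ∣ (⊴⇒r-∪⁅⁆-< M M' M⊴M' (p∩q⊆q X A) e∈A (+-cancelʳ-< ∣ X ─ A ∣ _ _ increase))
  ... | no  e∉A rewrite ∪⁅⁆-∩-∉ X e∉A =
    +-monoʳ-< (r M' (X ∩ A)) (+-cancelˡ-< (r M (X ∩ A)) _ _ increase)

  ⊴⇒ρ₂≤ρ₁ : ∀ (M M' : Matroid A) (N : Matroid B) → Matched M N → Matched M' N → sys M ⊴ sys M' →
            ∀ X → ρ₂ M' N X ≤ ρ₁ M' X → ρ₂ M N X ≤ ρ₁ M X
  ⊴⇒ρ₂≤ρ₁ M M' N matched matched' M⊴M' X ρ₂'≤ρ₁' = +-cancelˡ-≤ (ρ₁ M' X) _ _ (begin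
    ρ₁ M' X + ρ₂ M N X                                  ≡⟨ cong (ρ₁ M' X +_) (+-comm (r N (X ∩ B)) (r M (A ─ B))) ⟩
    (r M' (X ∩ A) + ∣ X ─ A ∣) + (r M (A ─ B) + r N (X ∩ B))
                                                        ≡⟨ +-interchange (r M' (X ∩ A)) ∣ X ─ A ∣ (r M (A ─ B)) (r N (X ∩ B)) ⟩
    (r M' (X ∩ A) + r M (A ─ B)) + (∣ X ─ A ∣ + r N (X ∩ B))
                                                        ≤⟨ +-monoˡ-≤ (∣ X ─ A ∣ + r N (X ∩ B)) gap ⟩
    (r M (X ∩ A) + r M' (A ─ B)) + (∣ X ─ A ∣ + r N (X ∩ B))
                                                        ≡⟨ +-interchange (r M (X ∩ A)) (r M' (A ─ B)) ∣ X ─ A ∣ (r N (X ∩ B)) ⟩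
    (r M (X ∩ A) + ∣ X ─ A ∣) + (r M' (A ─ B) + r N (X ∩ B))
                                                        ≡⟨ cong (ρ₁ M X +_) (+-comm (r M' (A ─ B)) (r N (X ∩ B))) ⟩
    ρ₁ M X + ρ₂ M' N X                                  ≤⟨ +-monoʳ-≤ (ρ₁ M X) ρ₂'≤ρ₁' ⟩
    ρ₁ M X + ρ₁ M' X                                    ≡⟨ +-comm (ρ₁ M X) (ρ₁ M' X) ⟩
    ρ₁ M' X + ρ₁ M X                                    ∎)
    where
    open ≤-Reasoning
    -- r M' − r M is monotone, and matching with N makes its value at A equal to its value at A ─ B.
    gap : r M' (X ∩ A) + r M (A ─ B) ≤ r M (X ∩ A) + r M' (A ─ B)
    gap = +-cancelˡ-≤ (r N (A ∩ B)) _ _ (begin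
      r N (A ∩ B) + (r M' (X ∩ A) + r M (A ─ B))   ≡⟨ +-left-comm (r N (A ∩ B)) (r M' (X ∩ A)) (r M (A ─ B)) ⟩
      r M' (X ∩ A) + (r N (A ∩ B) + r M (A ─ B))   ≡⟨ cong (r M' (X ∩ A) +_) (sym (matched-rank M N matched ⊆-refl ─⊆A)) ⟩
      r M' (X ∩ A) + r M A                         ≤⟨ ⊴⇒r-gap-mono M M' M⊴M' (p∩q⊆q X A) ⊆-refl ⟩
      r M (X ∩ A) + r M' A                         ≡⟨ cong (r M (X ∩ A) +_) (matched-rank M' N matched' ⊆-refl ─⊆A) ⟩
      r M (X ∩ A) + (r N (A ∩ B) + r M' (A ─ B))   ≡⟨ +-left-comm (r M (X ∩ A)) (r N (A ∩ B)) (r M' (A ─ B)) ⟩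
      r N (A ∩ B) + (r M (X ∩ A) + r M' (A ─ B))   ∎)
      where
      ─⊆A : A ─ B ⊆ A
      ─⊆A = p─q⊆p A B

  ⋈-⊴ : ∀ (M : Matroid A) (N : Matroid B) (M' : Matroid A) (N' : Matroid B) →
        (∀ {X} → Flat (M ⋈ N) X → ∀ {e} → e ∈ A ∪ B → e ∉ X →
           ρ₁ M' X ≤ ρ₂ M' N' X → ρ₁ M' X < ρ₁ M' (X ∪ ⁅ e ⁆)) →
        (∀ {X} → Flat (M ⋈ N) X → ∀ {e} → e ∈ A ∪ B → e ∉ X →
           ρ₂ M' N' X ≤ ρ₁ M' X → ρ₂ M' N' X < ρ₂ M' N' (X ∪ ⁅ e ⁆)) →
        (M ⋈ N) ⊴ (M' ⋈ N')
  ⋈-⊴ _ _ M' N' ρ₁-grows ρ₂-grows = refl , λ X flat → proj₁ flat , λ e e∈A∪B e∉X →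
    ⊓-<-⊓ (ρ₁-grows flat e∈A∪B e∉X) (ρ₂-grows flat e∈A∪B e∉X) (ρ₁-∪⁅⁆-mono M' X e) (ρ₂-∪⁅⁆-mono M' N' X e)

  ⋈-mono-≤w : ∀ (M : Matroid A) (N : Matroid B) (M' : Matroid A) (N' : Matroid B) → sys M ≤w sys M' → sys N ≤w sys N' → (M ⋈ N) ≤w (M' ⋈ N')
  ⋈-mono-≤w M N M' N' M≤M' N≤N' = refl , λ X (X⊆A∪B , indep) → X⊆A∪B ,
    ≤-antisym (≤-trans (m⊓n≤m _ _) (ρ₁≤∣∣ M' X)) (begin
      ∣ X ∣                      ≡⟨ sym indep ⟩
      ρ₁ M X ⊓ ρ₂ M N X          ≤⟨ ⊓-mono-≤ (+-monoˡ-≤ ∣ X ─ A ∣ (≤w⇒r≤ M M' M≤M' (p∩q⊆q X A)))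
                                             (+-mono-≤ (≤w⇒r≤ N N' N≤N' (p∩q⊆q X B)) (≤w⇒r≤ M M' M≤M' (p─q⊆p A B))) ⟩
      ρ₁ M' X ⊓ ρ₂ M' N' X       ∎)
    where open ≤-Reasoning

  ⋈-mono-⊴ʳ : ∀ (M : Matroid A) (N N' : Matroid B) → Matched M N → sys N ⊴ sys N' → (M ⋈ N) ⊴ (M ⋈ N')
  ⋈-mono-⊴ʳ M N N' matched N⊴N' =
    ⋈-⊴ M N M N' (λ flat e∈A∪B e∉X _ → ⋈-flat⇒ρ₁-< M N matched flat e∈A∪B e∉X) ρ₂'-grows
    where
    ρ₂'-grows : ∀ {X} → Flat (M ⋈ N) X → ∀ {e} → e ∈ A ∪ B → e ∉ X →
                ρ₂ M N' X ≤ ρ₁ M X → ρ₂ M N' X < ρ₂ M N' (X ∪ ⁅ e ⁆)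
    ρ₂'-grows {X} (_ , flat) {e} e∈A∪B e∉X ρ₂'≤ρ₁ with ρ₂-<⇒r-< M N (⊓<⊓⇒<ʳ ρ₂≤ρ₁ (flat e e∈A∪B e∉X))
      where
      ρ₂≤ρ₁ : ρ₂ M N X ≤ ρ₁ M X
      ρ₂≤ρ₁ = ≤-trans (+-monoˡ-≤ (r M (A ─ B)) (⊴⇒r≤ N N' N⊴N' (p∩q⊆q X B))) ρ₂'≤ρ₁
    ... | e∈B , increase rewrite ∪⁅⁆-∩-∈ X e∈B =
      +-monoˡ-< (r M (A ─ B)) (⊴⇒r-∪⁅⁆-< N N' N⊴N' (p∩q⊆q X B) e∈B increase)

  ⋈-mono-⊴ˡ : ∀ (M M' : Matroid A) (N : Matroid B) → Matched M N → Matched M' N → sys M ⊴ sys M' →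
              (M ⋈ N) ⊴ (M' ⋈ N)
  ⋈-mono-⊴ˡ M M' N matched matched' M⊴M' =
    ⋈-⊴ M N M' N (λ flat e∈A∪B e∉X _ → ⊴⇒ρ₁-< M M' M⊴M' (⋈-flat⇒ρ₁-< M N matched flat e∈A∪B e∉X))
        ρ₂'-grows
    where
    ρ₂'-grows : ∀ {X} → Flat (M ⋈ N) X → ∀ {e} → e ∈ A ∪ B → e ∉ X →
                ρ₂ M' N X ≤ ρ₁ M' X → ρ₂ M' N X < ρ₂ M' N (X ∪ ⁅ e ⁆)
    ρ₂'-grows {X} (_ , flat) {e} e∈A∪B e∉X ρ₂'≤ρ₁' =
      +-monoˡ-< (r M' (A ─ B)) (+-cancelʳ-< (r M (A ─ B)) _ _
        (⊓<⊓⇒<ʳ (⊴⇒ρ₂≤ρ₁ M M' N matched matched' M⊴M' X ρ₂'≤ρ₁') (flat e e∈A∪B e∉X)))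

proposition3p9 : (n : ℕ) (A B : Subset n) (M : Matroid A) (N : Matroid B) → Matched M N →
    ((M' : Matroid A) (N' : Matroid B) → Matched M' N' → sys M ≤w sys M' → sys N ≤w sys N' → (M ⋈ N) ≤w (M' ⋈ N'))
    × ((N' : Matroid B) → Matched M N' → sys N ⊴ sys N' → (M ⋈ N) ⊴ (M ⋈ N'))
    × ((M' : Matroid A) → Matched M' N → sys M ⊴ sys M' → (M ⋈ N) ⊴ (M' ⋈ N))
proposition3p9 n A B M N matched =
    (λ M' N' _ → ⋈-mono-≤w M N M' N')
  , (λ N' _ → ⋈-mono-⊴ʳ M N N' matched)
  , (λ M' matched' → ⋈-mono-⊴ˡ M M' N matched matched')
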